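{- Let $A=(a_{\mathbf{i}})$ be a $d$-dimensional $\mathbb{N}$-matrix and $\pi=\Phi(A)$. Then $w_A=w(\pi)$.
   Context: A $d$-dimensional $\mathbb{N}$-matrix is an array $A=(a_{\mathbf{i}})_{\mathbf{i}\in\mathbb{Z}_+^d}$ of nonnegative integers with finitely many nonzero entries. A $d$-dimensional partition is such an array weakly decreasing in each coordinate. $\Phi(A)=G$ where $G_{\mathbf{i}}=\max_\Pi\sum_{\mathbf{j}\in\Pi}a_{\mathbf{j}}$, the maximum over directed lattice paths (steps $\mathbf{i}\to\mathbf{i}+\mathbf{e}_\ell$, $\ell\in[d]$) starting at $\mathbf{i}$. For variables $\mathbf{x}^{(k)}=(x^{(k)}_1,x^{(k)}_2,\ldots)$, $k\in[d]$, set $w_A=\prod_{(i_1,\ldots,i_d)}(x^{(1)}_{i_1}\cdots x^{(d)}_{i_d})^{a_{i_1,\ldots,i_d}}$ and, for a $d$-dimensional partition $\pi$, $w(\pi)=\prod_{(i_1,\ldots,i_{d+1})\in\mathrm{Cor}(\pi)}x^{(1)}_{i_1}\cdots x^{(d)}_{i_d}$, where $D(\pi)=\{(i_1,\ldots,i_d,i)\in\mathbb{Z}_+^{d+1}:1\le i\le\pi_{i_1,\ldots,i_d}\}$ and $\mathrm{Cor}(\pi)=\{\mathbf{i}\in D(\pi):\mathbf{i}+\mathbf{e}_\ell\notin D(\pi)\ \forall\ell\in[d]\}$ ($\mathbf{e}_\ell$ standard basis of $\mathbb{Z}^{d+1}$). -}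

module Defs where

open import Data.Nat using (ℕ; zero; suc; _+_; _≤_; _≤?_)
open import Data.Nat.Properties using (_≟_)
open import Data.Fin using (Fin)
import Data.Fin.Properties as FinP
open import Data.Nat.ListAction using (sum)
open import Data.List using (List; []; _∷_; map; upTo; concatMap; filter; length)
open import Data.Vec.Functional using (Vector)
import Data.Vec.Functional as VF
open import Data.Product using (_×_; ∃)
open import Relation.Nullary using (¬_; Dec; ¬?; _×-dec_)
open import Relation.Nullary.Decidable using (⌊_⌋)
open import Data.Bool using (if_then_else_)

-- Indices: ℤ₊ = {1,2,...} is encoded 0-based by ℕ (index i ↦ i-1).
-- A point of ℤ₊^d is a function Fin d → ℕ.
Point : ℕ → Set
Point d = Fin d → ℕ

-- A d-dimensional array of naturals (finite support is a separate hypothesis).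
Array : ℕ → Set
Array d = Point d → ℕ

_+e_ : ∀ {d} → Point d → Fin d → Point d
(i +e ℓ) k = if ⌊ k FinP.≟ ℓ ⌋ then suc (i k) else i k

SupportedIn : ∀ {d} → ℕ → Array d → Set
SupportedIn {d} N A = ∀ (i : Point d) (k : Fin d) → N ≤ i k → A i ≡ 0
  where open import Relation.Binary.PropositionalEquality using (_≡_)

-- A directed lattice path starting at i is given by its list of steps
-- (each step i ↦ i + e_ℓ); pathSum sums the entries of A at all visited points.
pathSum : ∀ {d} → Array d → Point d → List (Fin d) → ℕ
pathSum A i []       = A i
pathSum A i (ℓ ∷ ls) = A i + pathSum A (i +e ℓ) ls

IsΦ : ∀ {d} → Array d → Array d → Set
IsΦ A G = ∀ i → (∃ λ p → pathSum A i p ≡ G i) × (∀ p → pathSum A i p ≤ G i)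
  where open import Relation.Binary.PropositionalEquality using (_≡_)

box : (d N : ℕ) → List (Point d)
box zero    N = (λ ()) ∷ []
box (suc d) N = concatMap (λ j → map (λ i → j VF.∷ i) (box d N)) (upTo N)

-- Monomials in the variables x^{(k)}_m (k ∈ Fin d, m ∈ ℕ, 0-based) are
-- represented by their exponent functions Fin d → ℕ → ℕ.
Monomial : ℕ → Set
Monomial d = Fin d → ℕ → ℕ

-- w_A = ∏_i (x^{(1)}_{i_1} ⋯ x^{(d)}_{i_d})^{a_i}; the product runs over the box
-- {0,…,N-1}^d containing the support of A. Exponent of x^{(k)}_m:
wA : ∀ {d} → ℕ → Array d → Monomial d
wA {d} N A k m = sum (map (λ i → if ⌊ i k ≟ m ⌋ then A i else 0) (box d N))

-- (i , h) ∈ D(π): the last (height) coordinate h is the literal value, 1 ≤ h ≤ π_i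
InD : ∀ {d} → Array d → Point d → ℕ → Set
InD π i h = (1 ≤ h) × (h ≤ π i)

InD? : ∀ {d} (π : Array d) i h → Dec (InD π i h)
InD? π i h = (1 ≤? h) ×-dec (h ≤? π i)

IsCorner : ∀ {d} → Array d → Point d → ℕ → Set
IsCorner π i h = InD π i h × (∀ ℓ → ¬ InD π (i +e ℓ) h)

IsCorner? : ∀ {d} (π : Array d) i h → Dec (IsCorner π i h)
IsCorner? π i h = InD? π i h ×-dec FinP.all? (λ ℓ → ¬? (InD? π (i +e ℓ) h))

-- number of corners (i , h) over the base point i (all such h satisfy h ≤ π_i)
cornersAt : ∀ {d} → Array d → Point d → ℕ
cornersAt π i = length (filter (IsCorner? π i) (upTo (suc (π i))))

-- w(π) = ∏_{(i,h) ∈ Cor(π)} x^{(1)}_{i_1} ⋯ x^{(d)}_{i_d}, base points ranging over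
-- the box {0,…,N-1}^d. Exponent of x^{(k)}_m:
wπ : ∀ {d} → ℕ → Array d → Monomial d
wπ {d} N π k m = sum (map (λ i → if ⌊ i k ≟ m ⌋ then cornersAt π i else 0) (box d N))

{-# OPTIONS --safe #-}
-- Each a_i is recovered from π = Φ(A) at the single base point i: by the
-- recursion π_i = a_i + max_ℓ π_{i+e_ℓ} (or π_i = a_i if the optimal path
-- stops at i), the heights h with (i , h) ∈ Cor(π) are exactly
-- π_i - a_i < h ≤ π_i, so there are a_i of them.
module Submission where

open import Defs
open import Data.Nat using (ℕ; zero; suc; _+_; _∸_; _≤_; _<_; z≤n; s≤s; s≤s⁻¹; _≤?_)
open import Data.Nat.ListAction using (sum)
open import Data.Nat.Properties
open import Data.List using ([]; _∷_; filter; length; applyUpTo)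
open import Data.List.Properties using (filter-accept; filter-reject; map-cong)
open import Data.Product using (_,_; proj₁; proj₂; ∃)
open import Data.Sum using (_⊎_; inj₁; inj₂)
open import Data.Bool using (if_then_else_)
open import Data.Empty using (⊥-elim)
open import Function using (_∘_; id)
open import Function.Bundles using (_⇔_; mk⇔; Equivalence)
open import Relation.Nullary using (yes; no)
open import Relation.Nullary.Decidable using (⌊_⌋)
open import Relation.Unary using (Pred; Decidable)
open import Relation.Binary.PropositionalEquality using (_≡_; sym; trans; cong; subst)

open Equivalence using (to; from)

length-filter-applyUpTo-≥ : ∀ {p} {P : Pred ℕ p} (P? : Decidable P) (f : ℕ → ℕ) n b →
  (∀ h → h < n → P (f h) ⇔ b ≤ h) →
  length (filter P? (applyUpTo f n)) ≡ n ∸ b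
length-filter-applyUpTo-≥ P? f zero b _ = sym (0∸n≡0 b)
length-filter-applyUpTo-≥ P? f (suc n) zero P⇔ =
  trans (cong length (filter-accept P? (from (P⇔ 0 (s≤s z≤n)) z≤n)))
        (cong suc (length-filter-applyUpTo-≥ P? (f ∘ suc) n 0
                     (λ h h<n → mk⇔ (λ _ → z≤n) (λ _ → from (P⇔ (suc h) (s≤s h<n)) z≤n))))
length-filter-applyUpTo-≥ P? f (suc n) (suc b) P⇔ =
  trans (cong length (filter-reject P? (λ P₀ → n≮0 (to (P⇔ 0 (s≤s z≤n)) P₀))))
        (length-filter-applyUpTo-≥ P? (f ∘ suc) n b
           (λ h h<n → let e = P⇔ (suc h) (s≤s h<n) in
                      mk⇔ (s≤s⁻¹ ∘ to e) (from e ∘ s≤s)))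

module _ {d : ℕ} {A π : Array d} (Φ : IsΦ A π) where

  Φ-step : ∀ i ℓ → A i + π (i +e ℓ) ≤ π i
  Φ-step i ℓ with proj₁ (Φ (i +e ℓ))
  ... | p , sum≡ = subst (λ s → A i + s ≤ π i) sum≡ (proj₂ (Φ i) (ℓ ∷ p))

  Φ-tight : ∀ i → π i ≡ A i ⊎ ∃ λ ℓ → π i ≤ A i + π (i +e ℓ)
  Φ-tight i with proj₁ (Φ i)
  ... | [] , sum≡ = inj₁ (sym sum≡)
  ... | ℓ ∷ p , sum≡ =
    inj₂ (ℓ , subst (_≤ A i + π (i +e ℓ)) sum≡ (+-monoʳ-≤ (A i) (proj₂ (Φ (i +e ℓ)) p)))

  isCorner⇔ : ∀ i h → h ≤ π i → IsCorner π i h ⇔ π i ∸ A i < h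
  isCorner⇔ i h h≤π = mk⇔ above below
    where
    above : IsCorner π i h → π i ∸ A i < h
    above ((1≤h , _) , top) with Φ-tight i
    ... | inj₁ π≡A = subst (_< h) (sym (trans (cong (_∸ A i) π≡A) (n∸n≡0 (A i)))) 1≤h
    ... | inj₂ (ℓ , π≤) with h ≤? π (i +e ℓ)
    ...   | yes h≤π′ = ⊥-elim (top ℓ (1≤h , h≤π′))
    ...   | no h≰π′ = ≤-<-trans (m≤n+o⇒m∸n≤o (π i) (A i) π≤) (≰⇒> h≰π′)

    below : π i ∸ A i < h → IsCorner π i h
    below c<h = (≤-trans (s≤s z≤n) c<h , h≤π) , λ ℓ (_ , h≤π′) →
      <⇒≱ c<h (m+n≤o⇒m≤o∸n h (≤-trans (≤-reflexive (+-comm h (A i)))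
                (≤-trans (+-monoʳ-≤ (A i) h≤π′) (Φ-step i ℓ))))

  cornersAt-Φ : ∀ i → cornersAt π i ≡ A i
  cornersAt-Φ i =
    trans (length-filter-applyUpTo-≥ (IsCorner? π i) id (suc (π i)) (suc (π i ∸ A i))
             (λ h h<1+π → isCorner⇔ i h (s≤s⁻¹ h<1+π)))
          (m∸[m∸n]≡n (proj₂ (Φ i) []))

lemma4p3 : (d N : ℕ) (A π : Array d) → SupportedIn N A → IsΦ A π →
             ∀ k m → wA N A k m ≡ wπ N π k m
lemma4p3 d N A π _ Φ k m =
  cong sum (map-cong (λ i → cong (λ a → if ⌊ i k ≟ m ⌋ then a else 0) (sym (cornersAt-Φ Φ i)))
                     (box d N))
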